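{- Let $G$ be a threshold graph and let $e$ be a key edge of $G$. Then $G-e$ is a threshold graph.
   Context: A finite simple graph $G$ is a threshold graph if there exist a function $f:V(G)\to\mathbb{R}$ with nonnegative values and a nonnegative real number $t$ such that for any two distinct vertices $u,v$, $u$ and $v$ are adjacent if and only if $f(u)+f(v)>t$. Degree partition: if the distinct positive vertex degrees of $G$ are $\delta_1<\cdots<\delta_m$, let $D_i=\{v\in V(G):\deg(v)=\delta_i\}$ for $i=1,\ldots,m$ (and $D_0$ the set of isolated vertices). For $S,T\subseteq V(G)$ (not necessarily disjoint), $[S,T]$ denotes the set of edges of $G$ with one end in $S$ and the other end in $T$. An edge of a threshold graph $G$ is a key edge if it lies in $[D_k,D_{m+1-k}]$ for some $k$ with $1\le k\le\lceil m/2\rceil$.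
   Formalization: The weight function f and the threshold t in the definition of a threshold graph take values in the rationals instead of the reals. -}

module Defs where

open import Data.Nat as ℕ using (ℕ; zero; suc; _≤_; _<_; ⌈_/2⌉)
open import Data.Fin using (Fin; _≟_)
open import Data.Bool using (Bool; true; false; _∧_; _∨_; not)
open import Data.Bool.Properties using (∨-comm; ∧-comm)
open import Data.List using (List; filter; length; allFin; upTo; map)
open import Data.List.Relation.Unary.Any using (any?)
open import Data.Product using (Σ; _×_; ∃; ∃-syntax; _,_)
open import Data.Sum using (_⊎_)
open import Data.Rational using (ℚ; 0ℚ) renaming (_+_ to _+ℚ_; _<_ to _<ℚ_; _≤_ to _≤ℚ_)
open import Function.Bundles using (_⇔_)
open import Relation.Nullary using (¬_)
open import Relation.Nullary.Decidable using (⌊_⌋; _×-dec_)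
open import Relation.Binary.PropositionalEquality using (_≡_; _≢_; refl; cong₂)
open import Data.Nat.Properties using () renaming (_≟_ to _≟ℕ_)
import Data.Nat.Properties as ℕP

record SimpleGraph (n : ℕ) : Set where
  field
    adj    : Fin n → Fin n → Bool
    sym    : ∀ u v → adj u v ≡ adj v u
    irrefl : ∀ v → adj v v ≡ false

open SimpleGraph public

IsThreshold : ∀ {n} → SimpleGraph n → Set
IsThreshold {n} G =
  Σ (Fin n → ℚ) λ f → Σ ℚ λ t →
    (∀ v → 0ℚ ≤ℚ f v) × (0ℚ ≤ℚ t) ×
    (∀ u v → u ≢ v → (adj G u v ≡ true ⇔ t <ℚ f u +ℚ f v))

deg : ∀ {n} → SimpleGraph n → Fin n → ℕ
deg {n} G v = length (filter (λ u → adj G v u Data.Bool.≟ true) (allFin n))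

positiveDegrees : ∀ {n} → SimpleGraph n → List ℕ
positiveDegrees {n} G =
  filter (λ d → (1 ℕ.≤? d) ×-dec any? (λ v → deg G v ≟ℕ d) (allFin n)) (upTo n)

numDegrees : ∀ {n} → SimpleGraph n → ℕ
numDegrees G = length (positiveDegrees G)

-- the index i with deg v = δᵢ (meaningful when deg v > 0)
degRank : ∀ {n} → SimpleGraph n → Fin n → ℕ
degRank G v = length (filter (λ d → d ℕ.≤? deg G v) (positiveDegrees G))

InD : ∀ {n} → SimpleGraph n → ℕ → Fin n → Set
InD G i v = (1 ≤ deg G v) × (degRank G v ≡ i)

IsKeyEdge : ∀ {n} → SimpleGraph n → Fin n → Fin n → Set
IsKeyEdge G u v =
  (adj G u v ≡ true) ×
  ∃[ k ] (1 ≤ k) × (k ≤ ⌈ numDegrees G /2⌉) ×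
    ((InD G k u × InD G (suc (numDegrees G) ℕ.∸ k) v) ⊎
     (InD G k v × InD G (suc (numDegrees G) ℕ.∸ k) u))

sameEdge : ∀ {n} → Fin n → Fin n → Fin n → Fin n → Bool
sameEdge u v x y = (⌊ x ≟ u ⌋ ∧ ⌊ y ≟ v ⌋) ∨ (⌊ x ≟ v ⌋ ∧ ⌊ y ≟ u ⌋)

sameEdge-swap : ∀ {n} (u v x y : Fin n) → sameEdge u v x y ≡ sameEdge u v y x
sameEdge-swap u v x y
  rewrite ∧-comm ⌊ y ≟ u ⌋ ⌊ x ≟ v ⌋ | ∧-comm ⌊ y ≟ v ⌋ ⌊ x ≟ u ⌋ =
  ∨-comm (⌊ x ≟ u ⌋ ∧ ⌊ y ≟ v ⌋) (⌊ x ≟ v ⌋ ∧ ⌊ y ≟ u ⌋)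

deleteEdge : ∀ {n} → SimpleGraph n → Fin n → Fin n → SimpleGraph n
deleteEdge G u v = record
  { adj    = λ x y → adj G x y ∧ not (sameEdge u v x y)
  ; sym    = λ x y → cong₂ (λ a b → a ∧ not b) (sym G x y) (sameEdge-swap u v x y)
  ; irrefl = λ x → cong₂ _∧_ (irrefl G x) refl
  }

module Submission where

-- Let m be the number of distinct positive degrees, rank x the index i with x ∈ D_i (0 for
-- isolated x), above x the number of positive degrees exceeding deg x (so rank x + above x = m),
-- and reach x the number of positive degrees d such that x has a neighbour of degree ≤ d.
--
-- From the weights one gets nested neighbourhoods: a neighbour of x is also a neighbour of every
-- other vertex of degree ≥ deg x.  This yields, for x ≠ y, that x ~ y iff above y < reach x.
-- Consequently the neighbourhood of x is a level set of above, which makes reach strictly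
-- increasing in the degree, and a descending induction over the degrees gives reach ≤ rank.
-- With score = rank + reach, edges have score sum ≥ 2m+2 and non-edges ≤ 2m, while the two
-- endpoints of a key edge have ranks summing to m+1, hence score sum at most 2m+2.
-- Finally, in any graph cut out by integer scores, an edge of minimal score sum can be deleted:
-- doubling the scores and adding 1 off the edge separates it from the remaining edges.

open import Defs renaming (sym to adj-sym)
open import Data.Nat as ℕ using (ℕ; zero; suc; _+_; _∸_; _≤_; _<_; z≤n; s≤s)
import Data.Nat.Properties as ℕ
open import Data.Nat.Induction using (<-rec)
open import Data.Nat.Tactic.RingSolver using (solve-∀)
open import Data.Integer using (+<+)
open import Data.Rational using (ℚ; 0ℚ; 1ℚ; *<*) renaming (_+_ to _+ℚ_; _<_ to _<ℚ_; _≤_ to _≤ℚ_)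
import Data.Rational.Properties as ℚ
open import Data.Fin using (Fin) renaming (_≟_ to _≟ᶠ_)
open import Data.Bool as Bool using (Bool; true; false; _∧_; _∨_; not)
open import Data.Bool.Properties using (∧-identityʳ; ∧-zeroʳ; ∨-zeroʳ)
open import Data.List using (List; []; _∷_; filter; length; allFin; upTo)
open import Data.List.Properties using (length-tabulate)
open import Data.List.Relation.Unary.Any as Any using (Any; here; there; any?)
open import Data.List.Relation.Unary.All as All using (All; []; _∷_)
open import Data.List.Relation.Unary.All.Properties using (all-filter)
open import Data.List.Relation.Unary.AllPairs using ([]; _∷_)
open import Data.List.Relation.Unary.Unique.Propositional using (Unique)
open import Data.List.Relation.Unary.Unique.Propositional.Properties using (upTo⁺; allFin⁺)
open import Data.List.Membership.Propositional using (_∈_; lose)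
open import Data.List.Membership.Propositional.Properties using (∈-allFin; ∈-upTo⁺; ∈-filter⁺)
open import Data.List.Extrema.Nat using (argmin; v<f[argmin]⁺; f[argmin]≤v⁺)
open import Data.Product using (Σ; _×_; _,_; proj₁; proj₂)
open import Data.Sum using (_⊎_; inj₁; inj₂)
open import Data.Empty using (⊥-elim)
open import Function.Base using (_∘_)
open import Function.Bundles using (_⇔_; mk⇔; Equivalence)
open import Relation.Unary using (Decidable)
open import Relation.Nullary using (¬_; Dec; yes; no; does)
open import Relation.Nullary.Decidable using (⌊_⌋; dec-true; dec-false; _×-dec_; _⊎-dec_)
open import Relation.Binary.Definitions using (DecidableEquality)
open import Relation.Binary.PropositionalEquality
  using (module ≡-Reasoning; _≡_; _≢_; refl; sym; trans; cong; cong₂; subst; subst₂)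

-- Boolean and decision-procedure bookkeeping.  sameEdge is phrased with ⌊_⌋ and the degree
-- notions with does; the two agree but not definitionally, hence both families of lemmas.
false≢true : false ≢ true
false≢true ()

∧-true⁻ : ∀ {a b} → a ∧ b ≡ true → a ≡ true × b ≡ true
∧-true⁻ {true} b = refl , b

∧-true⁺ : ∀ {a b} → a ≡ true → b ≡ true → a ∧ b ≡ true
∧-true⁺ = cong₂ _∧_

not-true⁻ : ∀ {a} → not a ≡ true → a ≡ false
not-true⁻ {false} _ = refl

∨-true⁻ : ∀ {a b} → a ∨ b ≡ true → a ≡ true ⊎ b ≡ true
∨-true⁻ {true} _ = inj₁ refl
∨-true⁻ {false} b = inj₂ b

isYes-true⁻ : ∀ {P : Set} (p : Dec P) → ⌊ p ⌋ ≡ true → P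
isYes-true⁻ (yes p) _ = p

isYes-true⁺ : ∀ {P : Set} (p : Dec P) → P → ⌊ p ⌋ ≡ true
isYes-true⁺ (yes _) _ = refl
isYes-true⁺ (no ¬p) p = ⊥-elim (¬p p)

does-true⁻ : ∀ {P : Set} (p : Dec P) → does p ≡ true → P
does-true⁻ (yes p) _ = p

does-false⁻ : ∀ {P : Set} (p : Dec P) → does p ≡ false → ¬ P
does-false⁻ (no ¬p) _ = ¬p

bit : Bool → ℕ
bit true = 1
bit false = 0

bit≤1 : ∀ b → bit b ≤ 1
bit≤1 true = ℕ.≤-refl
bit≤1 false = z≤n

bit-mono : ∀ {a b : Bool} → (a ≡ true → b ≡ true) → bit a ≤ bit b
bit-mono {false} _ = z≤n
bit-mono {true} a⇒b rewrite a⇒b refl = ℕ.≤-refl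

module _ {A : Set} where

  count : (A → Bool) → List A → ℕ
  count p [] = 0
  count p (a ∷ xs) = bit (p a) + count p xs

  length-filter : ∀ {P : A → Set} (P? : Decidable P) xs →
    length (filter P? xs) ≡ count (λ a → does (P? a)) xs
  length-filter P? [] = refl
  length-filter P? (x ∷ xs) with does (P? x)
  ... | true = cong suc (length-filter P? xs)
  ... | false = length-filter P? xs

  length-filter² : ∀ {P Q : A → Set} (P? : Decidable P) (Q? : Decidable Q) xs →
    length (filter Q? (filter P? xs)) ≡ count (λ a → does (P? a) ∧ does (Q? a)) xs
  length-filter² P? Q? [] = refl
  length-filter² P? Q? (x ∷ xs) with does (P? x)
  ... | false = length-filter² P? Q? xs
  ... | true with does (Q? x)
  ...   | true = cong suc (length-filter² P? Q? xs)
  ...   | false = length-filter² P? Q? xs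

  count-cong : ∀ {p q : A → Bool} {xs} → All (λ a → p a ≡ q a) xs → count p xs ≡ count q xs
  count-cong [] = refl
  count-cong (pa≡qa ∷ rest) = cong₂ _+_ (cong bit pa≡qa) (count-cong rest)

  count-mono : ∀ {p q : A → Bool} xs → (∀ a → p a ≡ true → q a ≡ true) → count p xs ≤ count q xs
  count-mono [] _ = z≤n
  count-mono (x ∷ xs) p⇒q = ℕ.+-mono-≤ (bit-mono (p⇒q x)) (count-mono xs p⇒q)

  count≤length : ∀ (p : A → Bool) xs → count p xs ≤ length xs
  count≤length p [] = z≤n
  count≤length p (x ∷ xs) = ℕ.+-mono-≤ (bit≤1 (p x)) (count≤length p xs)

  count<length : ∀ (p : A → Bool) {a} xs → a ∈ xs → p a ≡ false → count p xs < length xs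
  count<length p (x ∷ xs) (here refl) pa rewrite pa = s≤s (count≤length p xs)
  count<length p (x ∷ xs) (there a∈xs) pa =
    ℕ.+-mono-≤-< (bit≤1 (p x)) (count<length p xs a∈xs pa)

  count-member : ∀ (p : A → Bool) {a} xs → a ∈ xs → p a ≡ true → 1 ≤ count p xs
  count-member p (x ∷ xs) (here refl) pa rewrite pa = s≤s z≤n
  count-member p (x ∷ xs) (there a∈xs) pa = ℕ.≤-trans (count-member p xs a∈xs pa) (ℕ.m≤n+m _ (bit (p x)))

  count-witness : ∀ (p : A → Bool) xs → 0 < count p xs → Σ A λ a → p a ≡ true
  count-witness p (x ∷ xs) pos with p x in px
  ... | true = x , px
  ... | false = count-witness p xs pos

  count-none : ∀ (p : A → Bool) xs → (∀ a → p a ≡ false) → count p xs ≡ 0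
  count-none p [] _ = refl
  count-none p (x ∷ xs) none rewrite none x = count-none p xs none

  count-split : ∀ (p q : A → Bool) xs →
    count p xs ≡ count (λ a → p a ∧ q a) xs + count (λ a → p a ∧ not (q a)) xs
  count-split p q [] = refl
  count-split p q (x ∷ xs) with p x | q x
  ... | false | _ = count-split p q xs
  ... | true | true = cong suc (count-split p q xs)
  ... | true | false = trans (cong suc (count-split p q xs)) (sym (ℕ.+-suc _ _))

  count-tight : ∀ {p q : A → Bool} xs → (∀ a → p a ≡ true → q a ≡ true) →
    count q xs ≤ count p xs → ∀ {b} → b ∈ xs → q b ≡ true → p b ≡ true
  count-tight {p} {q} (x ∷ xs) p⇒q q≤p (here refl) qx with p x
  ... | true = refl
  ... | false rewrite qx = ⊥-elim (ℕ.<-irrefl refl (ℕ.≤-trans q≤p (count-mono xs p⇒q)))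
  count-tight {p} {q} (x ∷ xs) p⇒q q≤p (there b∈xs) qb =
    count-tight xs p⇒q (ℕ.+-cancelˡ-≤ (bit (q x)) _ _ (ℕ.≤-trans q≤p (ℕ.+-monoˡ-≤ _ (bit-mono (p⇒q x))))) b∈xs qb

  module Removal (_≟_ : DecidableEquality A) where

    _without_ : (A → Bool) → A → A → Bool
    (p without a) b = p b ∧ not (does (b ≟ a))

    without-elsewhere : ∀ p {a b} → b ≢ a → (p without a) b ≡ p b
    without-elsewhere p {a} {b} b≢a with b ≟ a
    ... | yes b≡a = ⊥-elim (b≢a b≡a)
    ... | no _ = ∧-identityʳ (p b)

    without-true⁻ : ∀ p {a b} → (p without a) b ≡ true → p b ≡ true × b ≢ a
    without-true⁻ p {a} {b} pb∧b≢a with ∧-true⁻ {p b} pb∧b≢a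
    ... | pb , b≢a = pb , does-false⁻ (b ≟ a) (not-true⁻ b≢a)

    without-true⁺ : ∀ p {a b} → p b ≡ true → b ≢ a → (p without a) b ≡ true
    without-true⁺ p pb b≢a = trans (without-elsewhere p b≢a) pb

    count-remove : ∀ (p : A → Bool) {a} xs → Unique xs → a ∈ xs →
      count p xs ≡ count (p without a) xs + bit (p a)
    count-remove p (x ∷ xs) (x∉xs ∷ _) (here refl) = begin
      bit (p x) + count p xs                                ≡⟨ ℕ.+-comm (bit (p x)) _ ⟩
      count p xs + bit (p x)                                ≡⟨ cong (_+ bit (p x)) (count-cong (All.map unchanged x∉xs)) ⟩
      count (p without x) xs + bit (p x)                    ≡⟨ cong (λ b → bit b + count (p without x) xs + bit (p x)) (sym x-removed) ⟩
      bit ((p without x) x) + count (p without x) xs + bit (p x) ∎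
      where
      open ≡-Reasoning
      unchanged : ∀ {b} → x ≢ b → p b ≡ (p without x) b
      unchanged x≢b = sym (without-elsewhere p (λ b≡x → x≢b (sym b≡x)))
      x-removed : (p without x) x ≡ false
      x-removed with x ≟ x
      ... | yes _ = ∧-zeroʳ (p x)
      ... | no x≢x = ⊥-elim (x≢x refl)
    count-remove p {a} (x ∷ xs) (x∉xs ∷ unique) (there a∈xs) = begin
      bit (p x) + count p xs                                        ≡⟨ cong (bit (p x) +_) (count-remove p xs unique a∈xs) ⟩
      bit (p x) + (count (p without a) xs + bit (p a))              ≡⟨ sym (ℕ.+-assoc (bit (p x)) _ _) ⟩
      bit (p x) + count (p without a) xs + bit (p a)                ≡⟨ cong (λ b → bit b + count (p without a) xs + bit (p a)) (sym (without-elsewhere p x≢a)) ⟩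
      bit ((p without a) x) + count (p without a) xs + bit (p a)    ∎
      where
      open ≡-Reasoning
      x≢a : x ≢ a
      x≢a = All.lookup x∉xs a∈xs

    count≤1 : ∀ (p : A → Bool) {a} xs → Unique xs → a ∈ xs →
      (∀ b → p b ≡ true → b ≡ a) → count p xs ≤ 1
    count≤1 p {a} xs unique a∈xs only-a = begin
      count p xs                             ≡⟨ count-remove p xs unique a∈xs ⟩
      count (p without a) xs + bit (p a)     ≡⟨ cong (_+ bit (p a)) (count-none (p without a) xs nowhere) ⟩
      bit (p a)                              ≤⟨ bit≤1 (p a) ⟩
      1                                      ∎
      where
      open ℕ.≤-Reasoning
      nowhere : ∀ b → (p without a) b ≡ false
      nowhere b with p b in pb
      ... | false = refl
      ... | true with b ≟ a
      ...   | yes _ = refl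
      ...   | no b≢a = ⊥-elim (b≢a (only-a b pb))

embed : ℕ → ℚ
embed zero = 0ℚ
embed (suc k) = 1ℚ +ℚ embed k

embed-+ : ∀ a b → embed (a + b) ≡ embed a +ℚ embed b
embed-+ zero b = sym (ℚ.+-identityˡ (embed b))
embed-+ (suc a) b = trans (cong (1ℚ +ℚ_) (embed-+ a b)) (sym (ℚ.+-assoc 1ℚ (embed a) (embed b)))

0<1 : 0ℚ <ℚ 1ℚ
0<1 = *<* (+<+ (s≤s z≤n))

embed-nonneg : ∀ k → 0ℚ ≤ℚ embed k
embed-nonneg zero = ℚ.≤-refl
embed-nonneg (suc k) = subst (_≤ℚ embed (suc k)) (ℚ.+-identityˡ 0ℚ) (ℚ.+-mono-≤ (ℚ.<⇒≤ 0<1) (embed-nonneg k))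

embed-≤ : ∀ {a b} → a ≤ b → embed a ≤ℚ embed b
embed-≤ {zero} {b} _ = embed-nonneg b
embed-≤ {suc a} {suc b} (s≤s a≤b) = ℚ.+-monoʳ-≤ 1ℚ (embed-≤ a≤b)

embed-< : ∀ {a b} → a < b → embed a <ℚ embed b
embed-< {zero} {suc b} _ = subst (_<ℚ embed (suc b)) (ℚ.+-identityʳ 0ℚ) (ℚ.+-mono-<-≤ 0<1 (embed-nonneg b))
embed-< {suc a} {suc b} (s≤s a<b) = ℚ.+-monoʳ-< 1ℚ (embed-< a<b)

embed-<-sum : ∀ c a b → (c < a + b ⇔ embed c <ℚ embed a +ℚ embed b)
embed-<-sum c a b = mk⇔ preserve reflect
  where
  preserve : c < a + b → embed c <ℚ embed a +ℚ embed b
  preserve c<a+b = subst (embed c <ℚ_) (embed-+ a b) (embed-< c<a+b)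
  reflect : embed c <ℚ embed a +ℚ embed b → c < a + b
  reflect embedded with c ℕ.<? a + b
  ... | yes c<a+b = c<a+b
  ... | no c≮a+b = ⊥-elim (ℚ.<-irrefl refl (ℚ.<-≤-trans embedded
                     (subst (_≤ℚ embed c) (embed-+ a b) (embed-≤ (ℕ.≮⇒≥ c≮a+b)))))

SeparatedBy : ∀ {n} → SimpleGraph n → (Fin n → ℕ) → ℕ → Set
SeparatedBy {n} G g M = ∀ x y → x ≢ y → (adj G x y ≡ true ⇔ M < g x + g y)

doubled-threshold : ∀ M s c → 1 ≤ c → c ≤ 2 → (M < s ⇔ suc M + suc M < s + s + c)
doubled-threshold M s c 1≤c c≤2 = mk⇔ raise lower
  where
  raise : M < s → suc M + suc M < s + s + c
  raise M<s = subst (_< s + s + c) (ℕ.+-identityʳ _) (ℕ.+-mono-≤-< (ℕ.+-mono-≤ M<s M<s) 1≤c)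
  lower : suc M + suc M < s + s + c → M < s
  lower gap with M ℕ.<? s
  ... | yes M<s = M<s
  ... | no M≮s = ⊥-elim (ℕ.<⇒≱ gap (subst (s + s + c ≤_) (double-suc M)
                    (ℕ.+-mono-≤ (ℕ.+-mono-≤ s≤M s≤M) c≤2)))
    where
    s≤M : s ≤ M
    s≤M = ℕ.≮⇒≥ M≮s
    double-suc : ∀ M → M + M + 2 ≡ suc M + suc M
    double-suc = solve-∀

module _ {n} (u v : Fin n) where

  sameEdge-true⁻ : ∀ {x y} → sameEdge u v x y ≡ true → (x ≡ u × y ≡ v) ⊎ (x ≡ v × y ≡ u)
  sameEdge-true⁻ {x} {y} same with ∨-true⁻ same
  ... | inj₁ uv with ∧-true⁻ uv
  ...   | x≟u , y≟v = inj₁ (isYes-true⁻ (x ≟ᶠ u) x≟u , isYes-true⁻ (y ≟ᶠ v) y≟v)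
  sameEdge-true⁻ {x} {y} same | inj₂ vu with ∧-true⁻ vu
  ...   | x≟v , y≟u = inj₂ (isYes-true⁻ (x ≟ᶠ v) x≟v , isYes-true⁻ (y ≟ᶠ u) y≟u)

  Endpoint : Fin n → Set
  Endpoint x = x ≡ u ⊎ x ≡ v

  endpoints⇒sameEdge : ∀ {x y} → x ≢ y → Endpoint x → Endpoint y → sameEdge u v x y ≡ true
  endpoints⇒sameEdge x≢y (inj₁ refl) (inj₁ refl) = ⊥-elim (x≢y refl)
  endpoints⇒sameEdge x≢y (inj₁ refl) (inj₂ refl) =
    cong (_∨ (⌊ u ≟ᶠ v ⌋ ∧ ⌊ v ≟ᶠ u ⌋)) (cong₂ _∧_ (isYes-true⁺ (u ≟ᶠ u) refl) (isYes-true⁺ (v ≟ᶠ v) refl))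
  endpoints⇒sameEdge x≢y (inj₂ refl) (inj₁ refl) =
    trans (cong ((⌊ v ≟ᶠ u ⌋ ∧ ⌊ u ≟ᶠ v ⌋) ∨_) (cong₂ _∧_ (isYes-true⁺ (v ≟ᶠ v) refl) (isYes-true⁺ (u ≟ᶠ u) refl)))
          (∨-zeroʳ (⌊ v ≟ᶠ u ⌋ ∧ ⌊ u ≟ᶠ v ⌋))
  endpoints⇒sameEdge x≢y (inj₂ refl) (inj₂ refl) = ⊥-elim (x≢y refl)

  offEdge : Fin n → ℕ
  offEdge x with (x ≟ᶠ u) ⊎-dec (x ≟ᶠ v)
  ... | yes _ = 0
  ... | no _ = 1

  offEdge≤1 : ∀ x → offEdge x ≤ 1
  offEdge≤1 x with (x ≟ᶠ u) ⊎-dec (x ≟ᶠ v)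
  ... | yes _ = z≤n
  ... | no _ = ℕ.≤-refl

  offEdge-endpoint : ∀ {x} → Endpoint x → offEdge x ≡ 0
  offEdge-endpoint {x} endpoint with (x ≟ᶠ u) ⊎-dec (x ≟ᶠ v)
  ... | yes _ = refl
  ... | no notEndpoint = ⊥-elim (notEndpoint endpoint)

  offEdge-pair : ∀ {x y} → x ≢ y → sameEdge u v x y ≡ false → 1 ≤ offEdge x + offEdge y
  offEdge-pair {x} {y} x≢y different with (x ≟ᶠ u) ⊎-dec (x ≟ᶠ v) | (y ≟ᶠ u) ⊎-dec (y ≟ᶠ v)
  ... | no _ | _ = s≤s z≤n
  ... | yes _ | no _ = ℕ.≤-refl
  ... | yes x-end | yes y-end = ⊥-elim (false≢true (trans (sym different) (endpoints⇒sameEdge x≢y x-end y-end)))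

-- Deleting an edge whose endpoints have the least possible score sum from a graph cut out by
-- integer scores leaves a threshold graph: doubling the scores and adding offEdge separates
-- {u,v} from the remaining edges while keeping all non-edges below the threshold.
deleteTightEdge : ∀ {n} (G : SimpleGraph n) (g : Fin n → ℕ) (M : ℕ) (u v : Fin n) →
  SeparatedBy G g M → g u + g v ≤ suc M → IsThreshold (deleteEdge G u v)
deleteTightEdge {n} G g M u v separated tight =
  (λ x → embed (weight x)) , embed K , (λ x → embed-nonneg (weight x)) , embed-nonneg K ,
  λ x y x≢y → mk⇔ (Equivalence.to (embed-<-sum K (weight x) (weight y)) ∘ Equivalence.to (weight-separated x≢y))
                  (Equivalence.from (weight-separated x≢y) ∘ Equivalence.from (embed-<-sum K (weight x) (weight y)))
  where
  weight : Fin n → ℕ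
  weight x = g x + g x + offEdge u v x
  K : ℕ
  K = suc M + suc M

  weight-sum : ∀ x y → weight x + weight y ≡ (g x + g y) + (g x + g y) + (offEdge u v x + offEdge u v y)
  weight-sum x y = rearrange (g x) (g y) (offEdge u v x) (offEdge u v y)
    where
    rearrange : ∀ a b c d → (a + a + c) + (b + b + d) ≡ (a + b) + (a + b) + (c + d)
    rearrange = solve-∀

  deleted-pair : ∀ {x y} → (x ≡ u × y ≡ v) ⊎ (x ≡ v × y ≡ u) → weight x + weight y ≤ K
  deleted-pair {x} {y} pair = subst (_≤ K) (sym (weight-sum x y))
    (subst₂ _≤_ (cong ((g x + g y) + (g x + g y) +_) (sym off-sum)) (ℕ.+-identityʳ K)
      (ℕ.+-mono-≤ (ℕ.+-mono-≤ (pair-sum pair) (pair-sum pair)) z≤n))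
    where
    pair-sum : ∀ {x y} → (x ≡ u × y ≡ v) ⊎ (x ≡ v × y ≡ u) → g x + g y ≤ suc M
    pair-sum (inj₁ (refl , refl)) = tight
    pair-sum (inj₂ (refl , refl)) = subst (_≤ suc M) (ℕ.+-comm (g u) (g v)) tight
    endpoints : ∀ {x y} → (x ≡ u × y ≡ v) ⊎ (x ≡ v × y ≡ u) → Endpoint u v x × Endpoint u v y
    endpoints (inj₁ (x≡u , y≡v)) = inj₁ x≡u , inj₂ y≡v
    endpoints (inj₂ (x≡v , y≡u)) = inj₂ x≡v , inj₁ y≡u
    off-sum : offEdge u v x + offEdge u v y ≡ 0
    off-sum = cong₂ _+_ (offEdge-endpoint u v (proj₁ (endpoints pair))) (offEdge-endpoint u v (proj₂ (endpoints pair)))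

  weight-separated : ∀ {x y} → x ≢ y → (adj (deleteEdge G u v) x y ≡ true ⇔ K < weight x + weight y)
  weight-separated {x} {y} x≢y with sameEdge u v x y in same
  ... | true = mk⇔ (λ deleted → ⊥-elim (false≢true (trans (sym (∧-zeroʳ (adj G x y))) deleted)))
                  (λ above → ⊥-elim (ℕ.<⇒≱ above (deleted-pair (sameEdge-true⁻ u v same))))
  ... | false = mk⇔ (λ e → raise (Equivalence.to (separated x y x≢y) (trans (sym (∧-identityʳ _)) e)))
                   (λ above → trans (∧-identityʳ _) (Equivalence.from (separated x y x≢y) (lower above)))
    where
    perturbation = doubled-threshold M (g x + g y) (offEdge u v x + offEdge u v y)
      (offEdge-pair u v x≢y same) (ℕ.+-mono-≤ (offEdge≤1 u v x) (offEdge≤1 u v y))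
    raise : M < g x + g y → K < weight x + weight y
    raise M< = subst (K <_) (sym (weight-sum x y)) (Equivalence.to perturbation M<)
    lower : K < weight x + weight y → M < g x + g y
    lower above = Equivalence.from perturbation (subst (K <_) (weight-sum x y) above)

module ThresholdStructure {n : ℕ} (G : SimpleGraph n) (f : Fin n → ℚ) (t : ℚ)
  (threshold : ∀ x y → x ≢ y → (adj G x y ≡ true ⇔ t <ℚ f x +ℚ f y)) where

  open Removal (_≟ᶠ_ {n})

  infix 4 _~_
  _~_ : Fin n → Fin n → Set
  x ~ y = adj G x y ≡ true

  ~-sym : ∀ {x y} → x ~ y → y ~ x
  ~-sym {x} {y} x~y = trans (adj-sym G y x) x~y

  ~⇒≢ : ∀ {x y} → x ~ y → x ≢ y
  ~⇒≢ {x} x~y refl = false≢true (trans (sym (irrefl G x)) x~y)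

  weight-nested : ∀ {x x' z} → f x' ≤ℚ f x → z ≢ x → x' ~ z → x ~ z
  weight-nested {x} {x'} {z} x'≤x z≢x x'~z =
    Equivalence.from (threshold x z (λ x≡z → z≢x (sym x≡z)))
      (ℚ.<-≤-trans (Equivalence.to (threshold x' z (~⇒≢ x'~z)) x'~z) (ℚ.+-monoˡ-≤ (f z) x'≤x))

  deg-count : ∀ x → deg G x ≡ count (adj G x) (allFin n)
  deg-count x = trans (length-filter (λ z → adj G x z Bool.≟ true) (allFin n))
                      (count-cong (All.universal (λ z → does-≟true (adj G x z)) (allFin n)))
    where
    does-≟true : ∀ b → does (b Bool.≟ true) ≡ b
    does-≟true true = refl
    does-≟true false = refl

  deg<n : ∀ x → deg G x < n
  deg<n x = subst₂ _<_ (sym (deg-count x)) (length-tabulate (λ z → z))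
              (count<length (adj G x) (allFin n) (∈-allFin x) (irrefl G x))

  adjacent⇒positive-degree : ∀ {x y} → x ~ y → 1 ≤ deg G y
  adjacent⇒positive-degree {x} {y} x~y =
    subst (1 ≤_) (sym (deg-count y)) (count-member (adj G y) (allFin n) (∈-allFin x) (~-sym x~y))

  -- If x' is heavier this is weight-nested; otherwise
  -- N(x') - x ⊆ N(x) - x' and the degree bound forces equality of these sets.
  degree-dominance : ∀ {x y x'} → x ~ y → deg G x ≤ deg G x' → x' ≢ y → x' ~ y
  degree-dominance {x} {y} {x'} x~y x≤x' x'≢y with x ≟ᶠ x'
  ... | yes refl = x~y
  ... | no x≢x' with ℚ.≤-total (f x) (f x')
  ...   | inj₁ lighter = weight-nested lighter (λ y≡x' → x'≢y (sym y≡x')) x~y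
  ...   | inj₂ heavier = proj₁ (without-true⁻ (adj G x')
                           (count-tight (allFin n) N[x']-x⊆N[x]-x' N[x]-x'≤N[x']-x (∈-allFin y)
                              (without-true⁺ (adj G x) x~y (λ y≡x' → x'≢y (sym y≡x')))))
    where
    N[x']-x⊆N[x]-x' : ∀ z → (adj G x' without x) z ≡ true → (adj G x without x') z ≡ true
    N[x']-x⊆N[x]-x' z z∈ with without-true⁻ (adj G x') z∈
    ... | x'~z , z≢x = without-true⁺ (adj G x) (weight-nested heavier z≢x x'~z)
                         (λ z≡x' → ~⇒≢ x'~z (sym z≡x'))
    N[x]-x'≤N[x']-x : count (adj G x without x') (allFin n) ≤ count (adj G x' without x) (allFin n)
    N[x]-x'≤N[x']-x = ℕ.+-cancelʳ-≤ (bit (adj G x x')) _ _ (subst₂ _≤_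
      (trans (deg-count x) (count-remove (adj G x) (allFin n) (allFin⁺ n) (∈-allFin x')))
      (trans (deg-count x') (trans (count-remove (adj G x') (allFin n) (allFin⁺ n) (∈-allFin x))
             (cong (λ b → count (adj G x' without x) (allFin n) + bit b) (adj-sym G x' x))))
      x≤x')

  positiveDegree? : ∀ d → Dec (1 ≤ d × Any (λ v → deg G v ≡ d) (allFin n))
  positiveDegree? d = (1 ℕ.≤? d) ×-dec any? (λ v → deg G v ℕ.≟ d) (allFin n)

  isDegree : ℕ → Bool
  isDegree d = does (positiveDegree? d)

  isDegree⁻ : ∀ {d} → isDegree d ≡ true → Σ (Fin n) λ v → deg G v ≡ d
  isDegree⁻ {d} d-is-degree = Any.satisfied (proj₂ (does-true⁻ (positiveDegree? d) d-is-degree))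

  isDegree⁺ : ∀ v → 1 ≤ deg G v → isDegree (deg G v) ≡ true
  isDegree⁺ v positive = dec-true (positiveDegree? (deg G v)) (positive , lose (∈-allFin v) refl)

  m : ℕ
  m = numDegrees G

  m-count : m ≡ count isDegree (upTo n)
  m-count = length-filter positiveDegree? (upTo n)

  rank-count : ∀ x → degRank G x ≡ count (λ d → isDegree d ∧ does (d ℕ.≤? deg G x)) (upTo n)
  rank-count x = length-filter² positiveDegree? (λ d → d ℕ.≤? deg G x) (upTo n)

  above : Fin n → ℕ
  above x = count (λ d → isDegree d ∧ not (does (d ℕ.≤? deg G x))) (upTo n)

  rank+above : ∀ x → degRank G x + above x ≡ m
  rank+above x = sym (trans m-count (trans (count-split isDegree (λ d → does (d ℕ.≤? deg G x)) (upTo n))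
                                            (cong (_+ above x) (sym (rank-count x)))))

  above-antitone : ∀ {x y} → deg G x ≤ deg G y → above y ≤ above x
  above-antitone {x} {y} x≤y = count-mono (upTo n) λ d d-above-y →
    let (d-is-degree , d≰y) = ∧-true⁻ {isDegree d} d-above-y
    in ∧-true⁺ d-is-degree (cong not (dec-false (d ℕ.≤? deg G x)
         (λ d≤x → does-false⁻ (d ℕ.≤? deg G y) (not-true⁻ d≰y) (ℕ.≤-trans d≤x x≤y))))

  open Removal ℕ._≟_ using ()
    renaming (count-remove to count-remove-ℕ; count≤1 to count≤1-ℕ; _without_ to _without-degree_;
              without-true⁺ to without-degree-true⁺)

  nearNeighbour? : ∀ x d → Dec (Any (λ z → x ~ z × deg G z ≤ d) (allFin n))
  nearNeighbour? x d = any? (λ z → (adj G x z Bool.≟ true) ×-dec (deg G z ℕ.≤? d)) (allFin n)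

  reaches : Fin n → ℕ → Bool
  reaches x d = isDegree d ∧ does (nearNeighbour? x d)

  reach : Fin n → ℕ
  reach x = count (reaches x) (upTo n)

  reach≤m : ∀ x → reach x ≤ m
  reach≤m x = subst (reach x ≤_) (sym m-count) (count-mono (upTo n) λ d h → proj₁ (∧-true⁻ {isDegree d} h))

  -- If x ~ y, then x reaches deg y and, through y, every positive degree above deg y.
  adjacent⇒above<reach : ∀ {x y} → x ~ y → above y < reach x
  adjacent⇒above<reach {x} {y} x~y = begin
    suc (above y)              ≤⟨ s≤s (count-mono (upTo n) reaches-above) ⟩
    suc others                 ≡⟨ ℕ.+-comm 1 others ⟩
    others + 1                 ≡⟨ cong (λ b → others + bit b) (sym reaches-deg-y) ⟩
    others + bit (reaches x (deg G y))
                               ≡⟨ sym (count-remove-ℕ (reaches x) (upTo n) (upTo⁺ n) (∈-upTo⁺ (deg<n y))) ⟩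
    reach x                    ∎
    where
    open ℕ.≤-Reasoning
    others : ℕ
    others = count (reaches x without-degree deg G y) (upTo n)
    through-y : ∀ {d} → deg G y ≤ d → does (nearNeighbour? x d) ≡ true
    through-y y≤d = dec-true (nearNeighbour? x _) (lose (∈-allFin y) (x~y , y≤d))
    reaches-deg-y : reaches x (deg G y) ≡ true
    reaches-deg-y = ∧-true⁺ (isDegree⁺ y (adjacent⇒positive-degree x~y)) (through-y ℕ.≤-refl)
    reaches-above : ∀ d → isDegree d ∧ not (does (d ℕ.≤? deg G y)) ≡ true →
                    (reaches x without-degree deg G y) d ≡ true
    reaches-above d d-above-y =
      let (d-is-degree , d≰y) = ∧-true⁻ {isDegree d} d-above-y
          y<d = ℕ.≰⇒> (does-false⁻ (d ℕ.≤? deg G y) (not-true⁻ d≰y))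
      in without-degree-true⁺ (reaches x) (∧-true⁺ d-is-degree (through-y (ℕ.<⇒≤ y<d)))
                                (λ d≡y → ℕ.<-irrefl (sym d≡y) y<d)

  -- If x ≁ y, no neighbour of x has degree ≤ deg y (it would make y adjacent to x by
  -- degree-dominance), so every degree reached by x lies above deg y.
  nonadjacent⇒reach≤above : ∀ {x y} → x ≢ y → adj G x y ≡ false → reach x ≤ above y
  nonadjacent⇒reach≤above {x} {y} x≢y x≁y = count-mono (upTo n) λ d x-reaches-d →
    let (d-is-degree , near) = ∧-true⁻ {isDegree d} x-reaches-d
        (z , x~z , z≤d) = Any.satisfied (does-true⁻ (nearNeighbour? x d) near)
    in ∧-true⁺ d-is-degree (cong not (dec-false (d ℕ.≤? deg G y) λ d≤y →
         false≢true (trans (sym x≁y) (~-sym (degree-dominance (~-sym x~z) (ℕ.≤-trans z≤d d≤y)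
                                                                 (λ y≡x → x≢y (sym y≡x)))))))

  above<reach⇒adjacent : ∀ {x y} → x ≢ y → above y < reach x → x ~ y
  above<reach⇒adjacent {x} {y} x≢y above<reach with adj G x y in x?y
  ... | true = refl
  ... | false = ⊥-elim (ℕ.<⇒≱ above<reach (nonadjacent⇒reach≤above x≢y x?y))

  -- The level set of c: the vertices z with above z < c.  By the characterisation above, the
  -- neighbourhood of x is exactly its level set at c = reach x, with x removed.
  level : ℕ → Fin n → Bool
  level c z = does (above z ℕ.<? c)

  neighbours⊆level : ∀ {y c} → reach y ≤ c → deg G y + bit (level c y) ≤ count (level c) (allFin n)
  neighbours⊆level {y} {c} reach≤c = begin
    deg G y + bit (level c y)                             ≡⟨ cong (_+ bit (level c y)) (deg-count y) ⟩
    count (adj G y) (allFin n) + bit (level c y)          ≤⟨ ℕ.+-monoˡ-≤ _ (count-mono (allFin n) inside) ⟩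
    count (level c without y) (allFin n) + bit (level c y) ≡⟨ sym (count-remove (level c) (allFin n) (allFin⁺ n) (∈-allFin y)) ⟩
    count (level c) (allFin n)                            ∎
    where
    open ℕ.≤-Reasoning
    inside : ∀ z → y ~ z → (level c without y) z ≡ true
    inside z y~z = without-true⁺ (level c)
      (dec-true (above z ℕ.<? c) (ℕ.<-≤-trans (adjacent⇒above<reach y~z) reach≤c))
      (λ z≡y → ~⇒≢ y~z (sym z≡y))

  level⊆neighbours : ∀ x → count (level (reach x)) (allFin n) ≤ deg G x + bit (level (reach x) x)
  level⊆neighbours x = begin
    count (level (reach x)) (allFin n)                        ≡⟨ count-remove (level (reach x)) (allFin n) (allFin⁺ n) (∈-allFin x) ⟩
    count (level (reach x) without x) (allFin n) + bit (level (reach x) x)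
                                                              ≤⟨ ℕ.+-monoˡ-≤ _ (count-mono (allFin n) inside) ⟩
    count (adj G x) (allFin n) + bit (level (reach x) x)      ≡⟨ cong (_+ bit (level (reach x) x)) (sym (deg-count x)) ⟩
    deg G x + bit (level (reach x) x)                         ∎
    where
    open ℕ.≤-Reasoning
    inside : ∀ z → (level (reach x) without x) z ≡ true → x ~ z
    inside z z∈ = let (in-level , z≢x) = without-true⁻ (level (reach x)) z∈
                  in above<reach⇒adjacent (λ x≡z → z≢x (sym x≡z)) (does-true⁻ (above z ℕ.<? reach x) in-level)

  -- reach is strictly increasing in the degree: if reach y ≤ reach x, the neighbourhood of y fits
  -- into the level set of reach x, whose size is essentially deg x.
  reach-strict : ∀ {x y} → deg G x < deg G y → reach x < reach y
  reach-strict {x} {y} x<y with reach x ℕ.<? reach y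
  ... | yes reach-x<y = reach-x<y
  ... | no reach-x≮y = ⊥-elim (ℕ.<⇒≱ x<y (ℕ.+-cancelʳ-≤ (bit (level (reach x) y)) (deg G y) (deg G x) (begin
    deg G y + bit (level (reach x) y)    ≤⟨ neighbours⊆level (ℕ.≮⇒≥ reach-x≮y) ⟩
    count (level (reach x)) (allFin n)   ≤⟨ level⊆neighbours x ⟩
    deg G x + bit (level (reach x) x)    ≤⟨ ℕ.+-monoʳ-≤ (deg G x) (bit-mono x-in⇒y-in) ⟩
    deg G x + bit (level (reach x) y)    ∎)))
    where
    open ℕ.≤-Reasoning
    x-in⇒y-in : level (reach x) x ≡ true → level (reach x) y ≡ true
    x-in⇒y-in x-in = dec-true (above y ℕ.<? reach x)
      (ℕ.≤-<-trans (above-antitone (ℕ.<⇒≤ x<y)) (does-true⁻ (above x ℕ.<? reach x) x-in))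

  higher-vertex : ∀ x → 0 < above x → Σ (Fin n) λ y → deg G x < deg G y
  higher-vertex x positive =
    let (d , d-above-x) = count-witness _ (upTo n) positive
        (d-is-degree , d≰x) = ∧-true⁻ {isDegree d} d-above-x
        (y , y≡d) = isDegree⁻ d-is-degree
    in y , subst (deg G x <_) (sym y≡d) (ℕ.≰⇒> (does-false⁻ (d ℕ.≤? deg G x) (not-true⁻ d≰x)))

  -- If some positive degree exceeds deg x, take y of the next larger degree: the only positive
  -- degree in (deg x, deg y] is deg y itself, so above x = suc (above y).
  next-degree : ∀ x → 0 < above x → Σ (Fin n) λ y → deg G x < deg G y × above x ≤ suc (above y)
  next-degree x positive = y , x<y , above-x≤
    where
    y₀ = proj₁ (higher-vertex x positive)
    candidates = filter (λ z → deg G x ℕ.<? deg G z) (allFin n)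
    y = argmin (deg G) y₀ candidates
    x<y : deg G x < deg G y
    x<y = v<f[argmin]⁺ {f = deg G} {xs = candidates} (proj₂ (higher-vertex x positive)) (all-filter (λ z → deg G x ℕ.<? deg G z) (allFin n))
    y-least : ∀ z → deg G x < deg G z → deg G y ≤ deg G z
    y-least z x<z = f[argmin]≤v⁺ {f = deg G} y₀ candidates (inj₂ (lose (∈-filter⁺ (λ z → deg G x ℕ.<? deg G z) (∈-allFin z) x<z) ℕ.≤-refl))
    above-x : ℕ → Bool
    above-x d = isDegree d ∧ not (does (d ℕ.≤? deg G x))
    only-deg-y : ∀ d → above-x d ∧ does (d ℕ.≤? deg G y) ≡ true → d ≡ deg G y
    only-deg-y d h =
      let (d-above-x , d≤y) = ∧-true⁻ {above-x d} h
          (z , z≡d) = isDegree⁻ (proj₁ (∧-true⁻ {isDegree d} d-above-x))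
          x<z = subst (deg G x <_) (sym z≡d)
                  (ℕ.≰⇒> (does-false⁻ (d ℕ.≤? deg G x) (not-true⁻ (proj₂ (∧-true⁻ {isDegree d} d-above-x)))))
      in ℕ.≤-antisym (does-true⁻ (d ℕ.≤? deg G y) d≤y) (subst (deg G y ≤_) z≡d (y-least z x<z))
    also-above-y : ∀ d → above-x d ∧ not (does (d ℕ.≤? deg G y)) ≡ true →
                   isDegree d ∧ not (does (d ℕ.≤? deg G y)) ≡ true
    also-above-y d h = let (d-above-x , d≰y) = ∧-true⁻ {above-x d} h
                       in ∧-true⁺ (proj₁ (∧-true⁻ {isDegree d} d-above-x)) d≰y
    above-x≤ : above x ≤ suc (above y)
    above-x≤ = begin
      above x                                                           ≡⟨ count-split above-x (λ d → does (d ℕ.≤? deg G y)) (upTo n) ⟩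
      count (λ d → above-x d ∧ does (d ℕ.≤? deg G y)) (upTo n)
        + count (λ d → above-x d ∧ not (does (d ℕ.≤? deg G y))) (upTo n) ≤⟨ ℕ.+-mono-≤ (count≤1-ℕ _ (upTo n) (upTo⁺ n) (∈-upTo⁺ (deg<n y)) only-deg-y)
                                                                                        (count-mono (upTo n) also-above-y) ⟩
      suc (above y)                                                     ∎
      where open ℕ.≤-Reasoning

  -- reach x ≤ rank x, stated as reach x + above x ≤ m.  Induction down the degrees: at the top
  -- degree this is reach x ≤ m; below it, reach grows strictly when passing to the next degree
  -- while above drops by one.
  reach+above≤m : ∀ x → reach x + above x ≤ m
  reach+above≤m x = <-rec Bound step (n ∸ deg G x) x refl
    where
    Bound : ℕ → Set
    Bound k = ∀ x → n ∸ deg G x ≡ k → reach x + above x ≤ m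
    step : ∀ k → (∀ {j} → j < k → Bound j) → Bound k
    step k ih x refl with 0 ℕ.<? above x
    ... | no none-above = subst (_≤ m) (cong (reach x +_) (sym (ℕ.n≤0⇒n≡0 (ℕ.≮⇒≥ none-above))))
                                       (subst (_≤ m) (sym (ℕ.+-identityʳ (reach x))) (reach≤m x))
    ... | yes some-above = begin
      reach x + above x           ≤⟨ ℕ.+-monoʳ-≤ (reach x) above-x≤ ⟩
      reach x + suc (above y)     ≡⟨ ℕ.+-suc (reach x) (above y) ⟩
      suc (reach x) + above y     ≤⟨ ℕ.+-monoˡ-≤ (above y) (reach-strict x<y) ⟩
      reach y + above y           ≤⟨ ih (ℕ.∸-monoʳ-< x<y (ℕ.<⇒≤ (deg<n y))) y refl ⟩
      m                           ∎
      where
      open ℕ.≤-Reasoning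
      next = next-degree x some-above
      y = proj₁ next
      x<y = proj₁ (proj₂ next)
      above-x≤ = proj₂ (proj₂ next)

  reach≤rank : ∀ x → reach x ≤ degRank G x
  reach≤rank x = ℕ.+-cancelʳ-≤ (above x) (reach x) (degRank G x)
                   (subst (reach x + above x ≤_) (sym (rank+above x)) (reach+above≤m x))

  score : Fin n → ℕ
  score x = degRank G x + reach x

  score-sum : ∀ x y → score x + score y ≡ (degRank G x + reach y) + (degRank G y + reach x)
  score-sum x y = rearrange (degRank G x) (reach x) (degRank G y) (reach y)
    where
    rearrange : ∀ a b c d → (a + b) + (c + d) ≡ (a + d) + (c + b)
    rearrange = solve-∀

  -- Scores separate the graph: edges have score sum ≥ 2m+2 (each rank x + reach y exceeds
  -- rank x + above x = m), non-edges have score sum ≤ 2m.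
  score-separated : SeparatedBy G score (suc (m + m))
  score-separated x y x≢y = mk⇔ edge⇒high high⇒edge
    where
    open ℕ.≤-Reasoning
    edge⇒high : x ~ y → suc (m + m) < score x + score y
    edge⇒high x~y = begin-strict
      suc (m + m)                                          <⟨ s≤s (ℕ.≤-reflexive (sym (ℕ.+-suc m m))) ⟩
      suc m + suc m                                        ≡⟨ sym (cong₂ _+_ (rank+suc-above x) (rank+suc-above y)) ⟩
      (degRank G x + suc (above x)) + (degRank G y + suc (above y))
                                                           ≤⟨ ℕ.+-mono-≤ (ℕ.+-monoʳ-≤ (degRank G x) (adjacent⇒above<reach (~-sym x~y)))
                                                                         (ℕ.+-monoʳ-≤ (degRank G y) (adjacent⇒above<reach x~y)) ⟩
      (degRank G x + reach y) + (degRank G y + reach x)    ≡⟨ sym (score-sum x y) ⟩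
      score x + score y                                    ∎
      where
      rank+suc-above : ∀ z → degRank G z + suc (above z) ≡ suc m
      rank+suc-above z = trans (ℕ.+-suc (degRank G z) (above z)) (cong suc (rank+above z))
    high⇒edge : suc (m + m) < score x + score y → x ~ y
    high⇒edge high with adj G x y in x?y
    ... | true = refl
    ... | false = ⊥-elim (ℕ.<⇒≱ high (begin
      score x + score y                                    ≡⟨ score-sum x y ⟩
      (degRank G x + reach y) + (degRank G y + reach x)    ≤⟨ ℕ.+-mono-≤ (ℕ.+-monoʳ-≤ (degRank G x) (nonadjacent⇒reach≤above y≢x y≁x))
                                                                         (ℕ.+-monoʳ-≤ (degRank G y) (nonadjacent⇒reach≤above x≢y x?y)) ⟩
      (degRank G x + above x) + (degRank G y + above y)    ≡⟨ cong₂ _+_ (rank+above x) (rank+above y) ⟩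
      m + m                                                ≤⟨ ℕ.n≤1+n (m + m) ⟩
      suc (m + m)                                          ∎))
      where
      y≢x : y ≢ x
      y≢x y≡x = x≢y (sym y≡x)
      y≁x : adj G y x ≡ false
      y≁x = trans (adj-sym G y x) x?y

-- key indices k ≤ ⌈m/2⌉ satisfy k ≤ m + 1, so that k + (m + 1 - k) = m + 1
key-index-bound : ∀ {n} (G : SimpleGraph n) {k} → k ≤ ℕ.⌈ numDegrees G /2⌉ → k ≤ suc (numDegrees G)
key-index-bound G k≤⌈m/2⌉ = ℕ.m≤n⇒m≤1+n (ℕ.≤-trans k≤⌈m/2⌉ (ℕ.⌈n/2⌉≤n (numDegrees G)))

key-edge-ranks : ∀ {n} (G : SimpleGraph n) {u v : Fin n} → IsKeyEdge G u v →
  degRank G u + degRank G v ≡ suc (numDegrees G)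
key-edge-ranks G (_ , k , _ , k≤⌈m/2⌉ , inj₁ ((_ , rank-u≡k) , (_ , rank-v≡m+1-k))) =
  trans (cong₂ _+_ rank-u≡k rank-v≡m+1-k) (ℕ.m+[n∸m]≡n (key-index-bound G k≤⌈m/2⌉))
key-edge-ranks G (_ , k , _ , k≤⌈m/2⌉ , inj₂ ((_ , rank-v≡k) , (_ , rank-u≡m+1-k))) =
  trans (ℕ.+-comm (degRank G _) _)
        (trans (cong₂ _+_ rank-v≡k rank-u≡m+1-k) (ℕ.m+[n∸m]≡n (key-index-bound G k≤⌈m/2⌉)))

-- The scores of a threshold graph separate it at level 2m+1, and a key edge has score sum at
-- most 2m+2 since reach ≤ rank and its ranks sum to m+1; so deleteTightEdge applies.
lemma3 : ∀ {n : ℕ} (G : SimpleGraph n) (u v : Fin n) →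
    IsThreshold G → IsKeyEdge G u v → IsThreshold (deleteEdge G u v)
lemma3 G u v (f , t , _ , _ , threshold) key =
  deleteTightEdge G score (suc (m + m)) u v score-separated tight
  where
  open ThresholdStructure G f t threshold
  open ℕ.≤-Reasoning
  tight : score u + score v ≤ suc (suc (m + m))
  tight = begin
    score u + score v                                             ≤⟨ ℕ.+-mono-≤ (ℕ.+-monoʳ-≤ (degRank G u) (reach≤rank u))
                                                                                (ℕ.+-monoʳ-≤ (degRank G v) (reach≤rank v)) ⟩
    (degRank G u + degRank G u) + (degRank G v + degRank G v)     ≡⟨ regroup (degRank G u) (degRank G v) ⟩
    (degRank G u + degRank G v) + (degRank G u + degRank G v)     ≡⟨ cong₂ _+_ (key-edge-ranks G key) (key-edge-ranks G key) ⟩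
    suc m + suc m                                                 ≡⟨ cong suc (ℕ.+-suc m m) ⟩
    suc (suc (m + m))                                             ∎
    where
    regroup : ∀ a b → (a + a) + (b + b) ≡ (a + b) + (a + b)
    regroup = solve-∀
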